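{- Let $p,q$ be coprime positive integers with $p/q\in(0,1)$. Then the infinite word $1(z_{p,q}10)^\omega$ over $\{0,1\}$ is lexicographically strictly greater than each of its proper suffixes $\sigma^n(1(z_{p,q}10)^\omega)$, $n\ge1$.
   Context: For coprime $0<p<q$, the Christoffel word $t'_{p,q}=a'_0\cdots a'_{q-1}$ with $a'_i=\lceil (i+1)p/q\rceil-\lceil ip/q\rceil\in\{0,1\}$ factors as $1\,z_{p,q}\,0$, defining the central word $z_{p,q}$. $w^\omega$ denotes infinite repetition of the word $w$, $\sigma$ is the shift (deleting the first letter), and the lexicographic order is the usual one on infinite words over $\{0,1\}$. -}

module Defs where

open import Data.Nat using (ℕ; zero; suc; _+_; _*_; _∸_; _<_; NonZero)
open import Data.Nat.DivMod using (_/_; _%_)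
open import Data.List using (List; []; _∷_; _++_; map; upTo; length; lookup; drop; take)
open import Data.Fin using (Fin; fromℕ<)
open import Data.Product using (∃; _×_)
import Data.List.Properties
import Data.Nat.Properties
open import Relation.Binary.PropositionalEquality using (_≡_)

⌈_/_⌉ : ℕ → (q : ℕ) → .{{NonZero q}} → ℕ
⌈ m / q ⌉ = (m + (q ∸ 1)) / q

christoffelLetter : (p q : ℕ) → .{{NonZero q}} → ℕ → ℕ
christoffelLetter p q i = ⌈ suc i * p / q ⌉ ∸ ⌈ i * p / q ⌉

christoffel : (p q : ℕ) → .{{NonZero q}} → List ℕ
christoffel p q = map (christoffelLetter p q) (upTo q)

-- central word z_{p,q}: t'_{p,q} with its first letter (1) and last letter (0) removed
central : (p q : ℕ) → .{{NonZero q}} → List ℕ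
central p q = take (q ∸ 2) (drop 1 (christoffel p q))

InfWord : Set
InfWord = ℕ → ℕ

_^ω : (w : List ℕ) → .{{NonZero (length w)}} → InfWord
(w ^ω) i = lookup w (fromℕ< (Data.Nat.DivMod.m%n<n i (length w)))

_◂_ : ℕ → InfWord → InfWord
(a ◂ u) zero = a
(a ◂ u) (suc i) = u i

σ^ : ℕ → InfWord → InfWord
σ^ n u i = u (n + i)

_>lex_ : InfWord → InfWord → Set
u >lex v = ∃ λ k → ((i : ℕ) → i < k → u i ≡ v i) × (v k < u k)

z10 : (p q : ℕ) → .{{NonZero q}} → List ℕ
z10 p q = central p q ++ (1 ∷ 0 ∷ [])

z10-nonempty : (p q : ℕ) → .{{_ : NonZero q}} → NonZero (length (z10 p q))
z10-nonempty p q rewrite Data.List.Properties.length-++ (central p q) {1 ∷ 0 ∷ []}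
  | Data.Nat.Properties.+-comm (length (central p q)) 2 = _

theWord : (p q : ℕ) → .{{NonZero q}} → InfWord
theWord p q = 1 ◂ _^ω (z10 p q) {{z10-nonempty p q}}

NonZero-q : {p q : ℕ} → p < q → NonZero q
NonZero-q {q = suc q} _ = _

{-# OPTIONS --safe #-}
module Submission where

-- Write F k = ⌊kp/q⌋. For 0 < i < q coprimality gives ⌈ip/q⌉ = 1 + F i, so the letters of
-- z_{p,q} 1 0 are the differences F (r+2) − F (r+1), and as F (k+q) = F k + p the prefix of
-- length k+1 of u = 1 (z_{p,q} 1 0)^ω has sum 1 + F (k+1). The prefix of length k of the
-- suffix σ^(n+1) u therefore sums to F (n+1+k) − F (n+1) ≤ 1 + F k, which is the corresponding
-- sum for u, with the value p < 1 + p at k = q. Prefix sums that dominate everywhere and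
-- strictly somewhere force the lexicographic order, at the first position where the words differ.

open import Defs
open import Data.Nat
  using (ℕ; zero; suc; pred; _+_; _*_; _∸_; _⊓_; _≤_; _<_; z≤n; s≤s; _≟_; NonZero)
open import Data.Nat.Properties
open import Data.Nat.DivMod
open import Data.Nat.Divisibility using (_∣_; divides-refl; ∣⇒≤; m%n≡0⇒n∣m)
open import Data.Nat.Coprimality as Coprimality using (Coprime)
open import Data.Nat.Tactic.RingSolver using (solve-∀)
open import Data.List using (List; []; _∷_; _++_; map; applyUpTo; length; lookup; take)
open import Data.List.Properties using (length-take; length-map; length-applyUpTo; length-++)
open import Data.Fin using (fromℕ<)
open import Data.Product using (_,_)
open import Data.Sum using (inj₁; inj₂)
open import Data.Empty using (⊥-elim)
open import Function using (_∘_)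
open import Relation.Nullary using (yes; no; ¬_)
open import Relation.Binary using (tri<; tri≈; tri>)
open import Relation.Binary.PropositionalEquality

-- Positions past the end read as 0.
infixl 9 _‼_
_‼_ : List ℕ → ℕ → ℕ
[]       ‼ _     = 0
(x ∷ _)  ‼ zero  = x
(_ ∷ xs) ‼ suc i = xs ‼ i

lookup≡‼ : ∀ xs {i} (i<∣xs∣ : i < length xs) → lookup xs (fromℕ< i<∣xs∣) ≡ xs ‼ i
lookup≡‼ (x ∷ xs) {zero}  _             = refl
lookup≡‼ (x ∷ xs) {suc i} (s≤s i<∣xs∣) = lookup≡‼ xs i<∣xs∣

‼-++ˡ : ∀ xs ys {i} → i < length xs → (xs ++ ys) ‼ i ≡ xs ‼ i
‼-++ˡ (x ∷ xs) ys {zero}  _             = refl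
‼-++ˡ (x ∷ xs) ys {suc i} (s≤s i<∣xs∣) = ‼-++ˡ xs ys i<∣xs∣

‼-++ʳ : ∀ xs ys i → (xs ++ ys) ‼ (length xs + i) ≡ ys ‼ i
‼-++ʳ []       ys i = refl
‼-++ʳ (x ∷ xs) ys i = ‼-++ʳ xs ys i

‼-take : ∀ n xs {i} → i < n → take n xs ‼ i ≡ xs ‼ i
‼-take (suc n) []       _               = refl
‼-take (suc n) (x ∷ xs) {zero}  _       = refl
‼-take (suc n) (x ∷ xs) {suc i} (s≤s i<n) = ‼-take n xs i<n

‼-map-applyUpTo : ∀ (f g : ℕ → ℕ) n {i} → i < n → map f (applyUpTo g n) ‼ i ≡ f (g i)
‼-map-applyUpTo f g (suc n) {zero}  _         = refl
‼-map-applyUpTo f g (suc n) {suc i} (s≤s i<n) = ‼-map-applyUpTo f (g ∘ suc) n i<n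

[r+k*d]/d≡k : ∀ {r} k d .{{_ : NonZero d}} → r < d → (r + k * d) / d ≡ k
[r+k*d]/d≡k {r} k d r<d =
  trans (+-distrib-/-∣ʳ r (divides-refl k)) (cong₂ _+_ (m<n⇒m/n≡0 r<d) (m*n/n≡m k d))

m<[1+m/d]*d : ∀ m d .{{_ : NonZero d}} → m < suc (m / d) * d
m<[1+m/d]*d m d = begin-strict
  m                  ≡⟨ m≡m%n+[m/n]*n m d ⟩
  m % d + m / d * d  <⟨ +-monoˡ-< (m / d * d) (m%n<n m d) ⟩
  d + m / d * d      ∎
  where open ≤-Reasoning

/-subadditive : ∀ m n d .{{_ : NonZero d}} → (m + n) / d ≤ m / d + suc (n / d)
/-subadditive m n d = ≤-pred (m<n*o⇒m/o<n (begin-strict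
  m + n                            <⟨ +-mono-< (m<[1+m/d]*d m d) (m<[1+m/d]*d n d) ⟩
  suc (m / d) * d + suc (n / d) * d ≡⟨ *-distribʳ-+ d (suc (m / d)) (suc (n / d)) ⟨
  (suc (m / d) + suc (n / d)) * d  ∎))
  where open ≤-Reasoning

⌈/⌉≡1+/ : ∀ m d .{{_ : NonZero d}} → ¬ d ∣ m → ⌈ m / d ⌉ ≡ suc (m / d)
⌈/⌉≡1+/ m d@(suc d-1) d∤m with m % d in m%d≡r
... | zero  = ⊥-elim (d∤m (m%n≡0⇒n∣m m d m%d≡r))
... | suc r = begin
  (m + d-1) / d                   ≡⟨ cong (λ x → (x + d-1) / d) (m≡m%n+[m/n]*n m d) ⟩
  (m % d + m / d * d + d-1) / d   ≡⟨ cong (λ x → (x + m / d * d + d-1) / d) m%d≡r ⟩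
  (suc r + m / d * d + d-1) / d   ≡⟨ cong (_/ d) (shuffle r (m / d) d-1) ⟩
  (r + suc (m / d) * d) / d       ≡⟨ [r+k*d]/d≡k (suc (m / d)) d r<d ⟩
  suc (m / d)                     ∎
  where
  open ≡-Reasoning
  shuffle : ∀ r k c → suc r + k * suc c + c ≡ r + suc k * suc c
  shuffle = solve-∀
  r<d : r < d
  r<d = <⇒≤ (subst (_< d) m%d≡r (m%n<n m d))

prefixSum : InfWord → ℕ → ℕ
prefixSum u zero    = 0
prefixSum u (suc k) = prefixSum u k + u k

prefixSum-cong : ∀ {u v} m → (∀ i → i < m → u i ≡ v i) → prefixSum u m ≡ prefixSum v m
prefixSum-cong zero    u≗v = refl
prefixSum-cong (suc m) u≗v =
  cong₂ _+_ (prefixSum-cong m (λ i i<m → u≗v i (m<n⇒m<1+n i<m))) (u≗v m ≤-refl)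

prefixSum-σ^ : ∀ n u k → prefixSum u n + prefixSum (σ^ n u) k ≡ prefixSum u (n + k)
prefixSum-σ^ n u zero    = trans (+-identityʳ _) (cong (prefixSum u) (sym (+-identityʳ n)))
prefixSum-σ^ n u (suc k) = begin
  prefixSum u n + (prefixSum (σ^ n u) k + u (n + k))  ≡⟨ +-assoc (prefixSum u n) _ _ ⟨
  prefixSum u n + prefixSum (σ^ n u) k + u (n + k)    ≡⟨ cong (_+ u (n + k)) (prefixSum-σ^ n u k) ⟩
  prefixSum u (suc (n + k))                           ≡⟨ cong (prefixSum u) (+-suc n k) ⟨
  prefixSum u (n + suc k)                             ∎
  where open ≡-Reasoning

prefixSum-dominated⇒>lex : ∀ {u v} → (∀ k → prefixSum v k ≤ prefixSum u k) →
                          ∀ N → prefixSum v N < prefixSum u N → u >lex v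
prefixSum-dominated⇒>lex {u} {v} v≤u N = firstDifferenceFrom 0 N (λ _ ())
  where
  firstDifferenceFrom : ∀ m r → (∀ i → i < m → u i ≡ v i) →
                        prefixSum v (m + r) < prefixSum u (m + r) → u >lex v
  firstDifferenceFrom m zero u≗v v<u rewrite +-identityʳ m | prefixSum-cong m u≗v =
    ⊥-elim (<-irrefl refl v<u)
  firstDifferenceFrom m (suc r) u≗v v<u with u m ≟ v m
  ... | yes um≡vm = firstDifferenceFrom (suc m) r u≗v′
                        (subst (λ k → prefixSum v k < prefixSum u k) (+-suc m r) v<u)
    where
    u≗v′ : ∀ i → i < suc m → u i ≡ v i
    u≗v′ i i<1+m with m<1+n⇒m<n∨m≡n i<1+m
    ... | inj₁ i<m  = u≗v i i<m
    ... | inj₂ refl = um≡vm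
  ... | no um≢vm = m , u≗v , ≤∧≢⇒< vm≤um (um≢vm ∘ sym)
    where
    vm≤um : v m ≤ u m
    vm≤um = +-cancelˡ-≤ (prefixSum v m) (v m) (u m)
      (subst (λ s → prefixSum v m + v m ≤ s + u m) (prefixSum-cong m u≗v) (v≤u (suc m)))

module Slope (p q : ℕ) .{{_ : NonZero q}} where

  ⌊_*p/q⌋ : ℕ → ℕ
  ⌊ k *p/q⌋ = k * p / q

  ⌊*p/q⌋-periodic : ∀ k m → ⌊ k + m * q *p/q⌋ ≡ ⌊ k *p/q⌋ + m * p
  ⌊*p/q⌋-periodic k m = begin
    (k + m * q) * p / q          ≡⟨ cong (_/ q) (expand k m p q) ⟩
    (k * p + m * p * q) / q      ≡⟨ +-distrib-/-∣ʳ (k * p) (divides-refl (m * p)) ⟩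
    k * p / q + m * p * q / q    ≡⟨ cong (k * p / q +_) (m*n/n≡m (m * p) q) ⟩
    k * p / q + m * p            ∎
    where
    open ≡-Reasoning
    expand : ∀ k m p q → (k + m * q) * p ≡ k * p + m * p * q
    expand = solve-∀

  ⌊q*p/q⌋≡p : ⌊ q *p/q⌋ ≡ p
  ⌊q*p/q⌋≡p = trans (cong (_/ q) (*-comm q p)) (m*n/n≡m p q)

  ⌊*p/q⌋-subadditive : ∀ m n → ⌊ m + n *p/q⌋ ≤ ⌊ m *p/q⌋ + suc ⌊ n *p/q⌋
  ⌊*p/q⌋-subadditive m n =
    subst (λ x → x / q ≤ ⌊ m *p/q⌋ + suc ⌊ n *p/q⌋) (sym (*-distribʳ-+ p m n))
          (/-subadditive (m * p) (n * p) q)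

  prefixSum-1+⌊*p/q⌋⇒>lex-σ^ : (u : InfWord) → (∀ k → prefixSum u (suc k) ≡ suc ⌊ suc k *p/q⌋) →
                         ∀ n → u >lex σ^ (suc n) u
  prefixSum-1+⌊*p/q⌋⇒>lex-σ^ u Σu n = prefixSum-dominated⇒>lex dominated q below-at-q
    where
    v = σ^ (suc n) u
    start = ⌊ suc n *p/q⌋

    suffixSum : ∀ k → start + prefixSum v k ≡ ⌊ suc n + k *p/q⌋
    suffixSum k = suc-injective (trans (cong (_+ prefixSum v k) (sym (Σu n)))
                                       (trans (prefixSum-σ^ (suc n) u k) (Σu (n + k))))

    dominated : ∀ k → prefixSum v k ≤ prefixSum u k
    dominated zero    = z≤n
    dominated (suc k) = subst (prefixSum v (suc k) ≤_) (sym (Σu k))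
      (+-cancelˡ-≤ start _ _ (subst (_≤ start + suc ⌊ suc k *p/q⌋) (sym (suffixSum (suc k)))
                                     (⌊*p/q⌋-subadditive (suc n) (suc k))))

    prefixSum-u-q : prefixSum u q ≡ suc p
    prefixSum-u-q = trans (subst (λ k → prefixSum u k ≡ suc ⌊ k *p/q⌋) (suc-pred q) (Σu (pred q)))
                          (cong suc ⌊q*p/q⌋≡p)

    prefixSum-v-q : prefixSum v q ≡ p
    prefixSum-v-q = trans (+-cancelˡ-≡ start _ _ (trans (suffixSum q) one-period)) (*-identityˡ p)
      where
      one-period : ⌊ suc n + q *p/q⌋ ≡ start + 1 * p
      one-period = trans (cong ⌊_*p/q⌋ (cong (suc n +_) (sym (+-identityʳ q))))
                         (⌊*p/q⌋-periodic (suc n) 1)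

    below-at-q : prefixSum v q < prefixSum u q
    below-at-q = subst₂ _<_ (sym prefixSum-v-q) (sym prefixSum-u-q) ≤-refl

-- Parametrising p = a + 1 and q = a + e + 2 makes 0 < p < q hold by construction.
module CentralWord (a e : ℕ) (coprime : Coprime (suc a) (suc (suc (a + e)))) where

  p q : ℕ
  p = suc a
  q = suc (suc (a + e))

  open Slope p q

  p<q : p < q
  p<q = s≤s (s≤s (m≤m+n a e))

  ⌊1*p/q⌋≡0 : ⌊ 1 *p/q⌋ ≡ 0
  ⌊1*p/q⌋≡0 = m<n⇒m/n≡0 (subst (_< q) (sym (*-identityˡ p)) p<q)

  ⌊[q∸1]*p/q⌋≡a : ⌊ suc (a + e) *p/q⌋ ≡ a
  ⌊[q∸1]*p/q⌋≡a = trans (cong (_/ q) (expand a e)) ([r+k*d]/d≡k a q (s≤s (s≤s (m≤n+m e a))))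
    where
    expand : ∀ a e → suc (a + e) * suc a ≡ suc e + a * suc (suc (a + e))
    expand = solve-∀

  ⌊[1+q]*p/q⌋≡p : ⌊ suc q *p/q⌋ ≡ p
  ⌊[1+q]*p/q⌋≡p = trans (cong (_/ q) (expand a e)) ([r+k*d]/d≡k p q p<q)
    where
    expand : ∀ a e → suc (suc (suc (a + e))) * suc a ≡ suc a + suc a * suc (suc (a + e))
    expand = solve-∀

  ⌈i*p/q⌉≡1+⌊i*p/q⌋ : ∀ {i} → 0 < i → i < q → ⌈ i * p / q ⌉ ≡ suc ⌊ i *p/q⌋
  ⌈i*p/q⌉≡1+⌊i*p/q⌋ {i@(suc _)} _ i<q = ⌈/⌉≡1+/ (i * p) q q∤i*p
    where
    q∤i*p : ¬ q ∣ i * p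
    q∤i*p q∣i*p = <⇒≱ i<q (∣⇒≤ (Coprimality.coprime-divisor (Coprimality.sym coprime)
                                                          (subst (q ∣_) (*-comm i p) q∣i*p)))

  length-central : length (central p q) ≡ a + e
  length-central = begin
    length (central p q)                                    ≡⟨ length-take (a + e) _ ⟩
    (a + e) ⊓ length (map (christoffelLetter p q) (applyUpTo suc (suc (a + e))))
      ≡⟨ cong ((a + e) ⊓_) (trans (length-map (christoffelLetter p q) (applyUpTo suc (suc (a + e))))
                                      (length-applyUpTo suc (suc (a + e)))) ⟩
    (a + e) ⊓ suc (a + e)                                   ≡⟨ m≤n⇒m⊓n≡m (n≤1+n (a + e)) ⟩
    a + e                                                   ∎
    where open ≡-Reasoning

  central‼ : ∀ {r} → r < a + e → central p q ‼ r ≡ ⌊ suc (suc r) *p/q⌋ ∸ ⌊ suc r *p/q⌋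
  central‼ {r} r<a+e = begin
    central p q ‼ r                              ≡⟨ ‼-take (a + e) _ r<a+e ⟩
    map (christoffelLetter p q) (applyUpTo suc (suc (a + e))) ‼ r
      ≡⟨ ‼-map-applyUpTo (christoffelLetter p q) suc (suc (a + e)) (m<n⇒m<1+n r<a+e) ⟩
    ⌈ suc (suc r) * p / q ⌉ ∸ ⌈ suc r * p / q ⌉
      ≡⟨ cong₂ _∸_ (⌈i*p/q⌉≡1+⌊i*p/q⌋ (s≤s z≤n) (s≤s (s≤s r<a+e)))
                   (⌈i*p/q⌉≡1+⌊i*p/q⌋ (s≤s z≤n) (s≤s (m<n⇒m<1+n r<a+e))) ⟩
    ⌊ suc (suc r) *p/q⌋ ∸ ⌊ suc r *p/q⌋          ∎
    where open ≡-Reasoning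

  length-z10 : length (z10 p q) ≡ q
  length-z10 = trans (length-++ (central p q))
                     (trans (cong (_+ 2) length-central) (+-comm (a + e) 2))

  z10‼-suffix : ∀ i → z10 p q ‼ (a + e + i) ≡ (1 ∷ 0 ∷ []) ‼ i
  z10‼-suffix i = subst (λ n → z10 p q ‼ (n + i) ≡ (1 ∷ 0 ∷ []) ‼ i) length-central
                        (‼-++ʳ (central p q) (1 ∷ 0 ∷ []) i)

  z10‼+⌊*p/q⌋ : ∀ {r} → r < q → z10 p q ‼ r + ⌊ suc r *p/q⌋ ≡ ⌊ suc (suc r) *p/q⌋
  z10‼+⌊*p/q⌋ {r} r<q with <-cmp r (a + e)
  ... | tri< r<a+e _ _ = begin
    z10 p q ‼ r + ⌊ suc r *p/q⌋
      ≡⟨ cong (_+ ⌊ suc r *p/q⌋)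
              (‼-++ˡ (central p q) (1 ∷ 0 ∷ []) (subst (r <_) (sym length-central) r<a+e)) ⟩
    central p q ‼ r + ⌊ suc r *p/q⌋
      ≡⟨ cong (_+ ⌊ suc r *p/q⌋) (central‼ r<a+e) ⟩
    ⌊ suc (suc r) *p/q⌋ ∸ ⌊ suc r *p/q⌋ + ⌊ suc r *p/q⌋
      ≡⟨ m∸n+n≡m (/-monoˡ-≤ q (*-monoˡ-≤ p (n≤1+n (suc r)))) ⟩
    ⌊ suc (suc r) *p/q⌋ ∎
    where open ≡-Reasoning
  ... | tri≈ _ refl _ =
    trans (cong₂ _+_ (subst (λ n → z10 p q ‼ n ≡ 1) (+-identityʳ (a + e)) (z10‼-suffix 0))
                     ⌊[q∸1]*p/q⌋≡a)
          (sym ⌊q*p/q⌋≡p)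
  ... | tri> _ _ a+e<r with ≤-antisym (≤-pred r<q) a+e<r
  ... | refl =
    trans (cong₂ _+_ (subst (λ n → z10 p q ‼ n ≡ 0) (+-comm (a + e) 1) (z10‼-suffix 1))
                     ⌊q*p/q⌋≡p)
          (sym ⌊[1+q]*p/q⌋≡p)

  theWord-suc : ∀ j → theWord p q (suc j) ≡ z10 p q ‼ (j % q)
  theWord-suc j = trans (lookup≡‼ (z10 p q) (m%n<n j (length (z10 p q)) {{z10-nonempty p q}}))
                        (cong (z10 p q ‼_) (%-congʳ {{z10-nonempty p q}} length-z10))

  theWord-suc+⌊*p/q⌋ : ∀ j → theWord p q (suc j) + ⌊ suc j *p/q⌋ ≡ ⌊ suc (suc j) *p/q⌋
  theWord-suc+⌊*p/q⌋ j = begin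
    theWord p q (suc j) + ⌊ suc j *p/q⌋
      ≡⟨ cong₂ _+_ (theWord-suc j)
                   (trans (cong (⌊_*p/q⌋ ∘ suc) j≡r+t*q) (⌊*p/q⌋-periodic (suc r) t)) ⟩
    z10 p q ‼ r + (⌊ suc r *p/q⌋ + t * p)     ≡⟨ +-assoc (z10 p q ‼ r) _ _ ⟨
    z10 p q ‼ r + ⌊ suc r *p/q⌋ + t * p       ≡⟨ cong (_+ t * p) (z10‼+⌊*p/q⌋ (m%n<n j q)) ⟩
    ⌊ suc (suc r) *p/q⌋ + t * p               ≡⟨ ⌊*p/q⌋-periodic (suc (suc r)) t ⟨
    ⌊ suc (suc r) + t * q *p/q⌋               ≡⟨ cong (⌊_*p/q⌋ ∘ suc ∘ suc) j≡r+t*q ⟨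
    ⌊ suc (suc j) *p/q⌋                       ∎
    where
    open ≡-Reasoning
    r = j % q
    t = j / q
    j≡r+t*q : j ≡ r + t * q
    j≡r+t*q = m≡m%n+[m/n]*n j q

  prefixSum-theWord : ∀ k → prefixSum (theWord p q) (suc k) ≡ suc ⌊ suc k *p/q⌋
  prefixSum-theWord zero    = cong suc (sym ⌊1*p/q⌋≡0)
  prefixSum-theWord (suc k) = begin
    prefixSum (theWord p q) (suc k) + theWord p q (suc k)
      ≡⟨ cong (_+ theWord p q (suc k)) (prefixSum-theWord k) ⟩
    suc (⌊ suc k *p/q⌋ + theWord p q (suc k))
      ≡⟨ cong suc (+-comm ⌊ suc k *p/q⌋ (theWord p q (suc k))) ⟩
    suc (theWord p q (suc k) + ⌊ suc k *p/q⌋)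
      ≡⟨ cong suc (theWord-suc+⌊*p/q⌋ k) ⟩
    suc ⌊ suc (suc k) *p/q⌋
      ∎
    where open ≡-Reasoning

  theWord>lex-σ^ : ∀ n → theWord p q >lex σ^ (suc n) (theWord p q)
  theWord>lex-σ^ = prefixSum-1+⌊*p/q⌋⇒>lex-σ^ (theWord p q) prefixSum-theWord

corollary2p3 : (p q : ℕ) → (0<p : 0 < p) → (p<q : p < q) → Coprime p q →
    (n : ℕ) → theWord p q {{NonZero-q p<q}} >lex σ^ (suc n) (theWord p q {{NonZero-q p<q}})
corollary2p3 (suc a) (suc (suc q∸2)) (s≤s z≤n) (s≤s (s≤s a≤q∸2)) coprime
  with e , refl ← m≤n⇒∃[o]m+o≡n a≤q∸2 = CentralWord.theWord>lex-σ^ a e coprime
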